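{- Let $t\geq 2$ and let $H$ be a 3-uniform hypergraph on $[n]$ that does not contain $K_{2,t}$ as a trace. Let $A$ be the set of edges of $H$ containing at least one pair $\{u,w\}$ with $d_H(u,w)=1$. Then for any pair of distinct vertices $\{x,y\}$ we have $d_{H \setminus A}(x,y) \leq 3t-3$. Moreover, if $t=2$ then $d_{H\setminus A}(x,y) \leq 2$.
   Context: For a hypergraph $H$ and vertices $x,y$, the co-degree $d_H(x,y)$ is the number of edges of $H$ containing $\{x,y\}$; $H\setminus A$ denotes the hypergraph obtained from $H$ by deleting the edges in $A$. A 3-uniform hypergraph $H$ contains $K_{2,t}$ as a trace if there exist distinct vertices $x,y,u_1,\dots,u_t$ and $2t$ distinct edges $e_{x,1},\dots,e_{x,t},e_{y,1},\dots,e_{y,t}$ of $H$ such that, with $S=\{x,y,u_1,\dots,u_t\}$, we have $e_{x,i}\cap S=\{x,u_i\}$ and $e_{y,i}\cap S=\{y,u_i\}$ for all $i$. -}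

module Defs where

open import Data.Nat using (ℕ)
open import Data.Fin using (Fin)
open import Data.Fin.Properties using (any?) renaming (_≟_ to _≟ᶠ_)
open import Data.Fin.Subset using (Subset; _∈_; ∣_∣)
open import Data.Fin.Subset.Properties using (_∈?_)
open import Data.List using (List; length; filter)
open import Data.List.Relation.Unary.All using (All)
open import Data.List.Relation.Unary.Unique.Propositional using (Unique)
import Data.List.Membership.Propositional as LM
open import Data.Nat.Properties renaming (_≟_ to _≟ℕ_)
open import Data.Product using (Σ; ∃; _×_; _,_)
open import Data.Sum using (_⊎_)
open import Relation.Nullary using (¬_; Dec; ¬?)
open import Relation.Nullary.Decidable using (_×-dec_)
open import Relation.Binary.PropositionalEquality using (_≡_; _≢_)
open import Function.Definitions using (Injective)
open import Function.Bundles using (_⇔_)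

record Hypergraph3 (n : ℕ) : Set where
  field
    edges   : List (Subset n)
    unique  : Unique edges
    uniform : All (λ e → ∣ e ∣ ≡ 3) edges
open Hypergraph3 public

codeg : ∀ {n} → List (Subset n) → Fin n → Fin n → ℕ
codeg E x y = length (filter (λ e → (x ∈? e) ×-dec (y ∈? e)) E)

d : ∀ {n} → Hypergraph3 n → Fin n → Fin n → ℕ
d H = codeg (edges H)

InA : ∀ {n} → Hypergraph3 n → Subset n → Set
InA H e = ∃ λ u → ∃ λ w → (u ≢ w) × (u ∈ e) × (w ∈ e) × (d H u w ≡ 1)

inA? : ∀ {n} (H : Hypergraph3 n) (e : Subset n) → Dec (InA H e)
inA? H e = any? λ u → any? λ w →
  (¬? (u ≟ᶠ w)) ×-dec ((u ∈? e) ×-dec ((w ∈? e) ×-dec (d H u w ≟ℕ 1)))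

edgesMinusA : ∀ {n} → Hypergraph3 n → List (Subset n)
edgesMinusA H = filter (λ e → ¬? (inA? H e)) (edges H)

dMinusA : ∀ {n} → Hypergraph3 n → Fin n → Fin n → ℕ
dMinusA H = codeg (edgesMinusA H)

record K2tTrace {n : ℕ} (t : ℕ) (H : Hypergraph3 n) : Set where
  field
    x y : Fin n
    u   : Fin t → Fin n
    x≢y : x ≢ y
    u-inj : Injective _≡_ _≡_ u
    x∉u : ∀ i → u i ≢ x
    y∉u : ∀ i → u i ≢ y
    -- e (inj₁ i) = e_{x,i},  e (inj₂ i) = e_{y,i}; all 2t edges distinct
    e     : Fin t ⊎ Fin t → Subset n
    e-inj : Injective _≡_ _≡_ e
    e∈H   : ∀ k → e k LM.∈ edges H
  InS : Fin n → Set
  InS v = v ≡ x ⊎ v ≡ y ⊎ ∃ λ j → v ≡ u j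
  field
    trace-x : ∀ i v → ((v ∈ e (Data.Sum.inj₁ i)) × InS v) ⇔ (v ≡ x ⊎ v ≡ u i)
    trace-y : ∀ i v → ((v ∈ e (Data.Sum.inj₂ i)) × InS v) ⇔ (v ≡ y ⊎ v ≡ u i)

ContainsK2tTrace : ∀ {n} → ℕ → Hypergraph3 n → Set
ContainsK2tTrace t H = K2tTrace t H

-- Fix x ≠ y and let Z be the third vertices z of the edges xyz of H ∖ A, so |Z| = d_{H∖A}(x,y).
-- As xyz ∉ A, the pairs cz with c ∈ {x,y} have co-degree at least 2, so on each side c the vertex
-- z has a partner p ∉ {x,y,z} with cpz an edge.  Leaves u₁, …, u_t are picked greedily from Z:
-- each new leaf w reserves on each side c a partner r_c that is not a leaf, and the edges c w r_c
-- become the edges e_{c,i} of the trace.  The pool loses at most w, r_x and r_y, so |Z| ≥ 3t − 2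
-- suffices, provided every remaining candidate keeps a partner that is not a leaf.  This can only
-- fail if w is overloaded: two candidates are forced to w, i.e. have w as their only available
-- partner, on the same side.  A candidate is forced to at most one vertex per side and is not
-- overloaded on a side where it is forced; so if every candidate were overloaded, choosing two
-- candidates forced to each would give 2|Z| distinct elements of Z.
-- For t = 2, three vertices of Z suffice: either two of them have partners avoiding each other on
-- both sides, or each pair lies in an edge with x or y, and two of these pairs share a vertex k and
-- a centre c; the spine edges through the other centre and the edges through c and k then trace
-- a K_{2,2}.

module Submission where

open import Defs
open import Data.Bool using (Bool; true; false; not; if_then_else_)
open import Data.Bool.Properties using () renaming (_≟_ to _≟ᵇ_)
open import Data.Empty using (⊥-elim)
open import Data.Fin using (Fin; zero; suc)
open import Data.Fin.Properties using (∀-cons) renaming (_≟_ to _≟ᶠ_; any? to anyᶠ?; all? to all?ᶠ)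
open import Data.Fin.Subset using (Subset; inside; outside; _∈_; _∉_; ∣_∣; _-_; ⁅_⁆; Nonempty; _⊆_)
open import Data.Fin.Subset.Properties
  using (_∈?_; x∈p⇒∣p-x∣<∣p∣; x∈p∧x≢y⇒x∈p-y; p─q⊆p; nonempty?; Empty-unique; ∣⊥∣≡0; p─⊥≡p; ⊆-antisym)
open import Data.List using (List; []; _∷_; length; filter; map)
open import Data.List.Properties using (length-map; filter-notAll; filter-all; filter-accept; filter-reject; filter-none)
open import Data.List.Relation.Unary.All as All using (All; []; _∷_)
open import Data.List.Relation.Unary.Any as Any using (Any; here; there; any?)
open import Data.List.Relation.Unary.AllPairs using ([]; _∷_)
open import Data.List.Relation.Unary.Unique.Propositional using (Unique)
import Data.List.Relation.Unary.Unique.Propositional.Properties as Unique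
open import Data.List.Membership.Propositional using (find) renaming (_∈_ to _∈ₗ_; _∉_ to _∉ₗ_)
open import Data.List.Membership.Propositional.Properties using (∈-filter⁺; ∈-filter⁻; ∈-map⁻)
open import Data.Nat using (ℕ; zero; suc; _≤_; _<_; _+_; _*_; _∸_; z≤n; s≤s)
open import Data.Nat.Properties
  using (≤-trans; <-irrefl; ≤-reflexive; ≤-pred; n≤1+n; n≮0; m+1+n≰m; m≤n+o⇒m∸n≤o; _≤?_; ≰⇒>; +-suc; +-identityʳ; *-comm; module ≤-Reasoning)
open import Data.Product using (_×_; _,_; proj₁; proj₂; ∃; ∃₂)
open import Data.Sum using (_⊎_; inj₁; inj₂)
open import Data.Vec.Functional using (Vector) renaming (_∷_ to _∷ᵥ_; [] to []ᵥ)
open import Data.Vec.Functional.Relation.Unary.Any using () renaming (Any to AnyV; any to anyV?)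
open import Data.Vec using (_∷_; here; there)
open import Data.Vec.Properties using (≡-dec)
open import Function.Bundles using (mk⇔)
open import Function.Definitions using (Injective)
open import Relation.Binary.Definitions using (DecidableEquality)
open import Relation.Unary using (Decidable)
open import Relation.Binary.PropositionalEquality using (_≡_; _≢_; refl; sym; trans; cong; subst; ≢-sym)
open import Relation.Nullary using (¬_; Dec; yes; no; ¬?)
open import Relation.Nullary.Decidable using (_×-dec_; _→-dec_; decidable-stable)

private
  variable
    n : ℕ

∣p∣≤1+∣p-x∣ : ∀ (p : Subset n) x → ∣ p ∣ ≤ suc ∣ p - x ∣
∣p∣≤1+∣p-x∣ (inside  ∷ p) zero    = s≤s (≤-reflexive (cong ∣_∣ (sym (p─⊥≡p p))))
∣p∣≤1+∣p-x∣ (outside ∷ p) zero    = ≤-trans (n≤1+n _) (s≤s (≤-reflexive (cong ∣_∣ (sym (p─⊥≡p p)))))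
∣p∣≤1+∣p-x∣ (inside  ∷ p) (suc x) = s≤s (∣p∣≤1+∣p-x∣ p x)
∣p∣≤1+∣p-x∣ (outside ∷ p) (suc x) = ∣p∣≤1+∣p-x∣ p x

x∈p-y⇒x≢y : ∀ {p : Subset n} {x y} → x ∈ p - y → x ≢ y
x∈p-y⇒x≢y {p = _ ∷ p} {zero}  {zero}  ()        refl
x∈p-y⇒x≢y {p = _ ∷ p} {suc x} {suc x} (there m) refl = x∈p-y⇒x≢y {p = p} m refl

x∈p-y⇒x∈p : ∀ {p : Subset n} {x y} → x ∈ p - y → x ∈ p
x∈p-y⇒x∈p {p = p} {y = y} = p─q⊆p p ⁅ y ⁆

x∈p⇒0<∣p∣ : ∀ {p : Subset n} {x} → x ∈ p → 0 < ∣ p ∣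
x∈p⇒0<∣p∣ x∈p = ≤-trans (s≤s z≤n) (x∈p⇒∣p-x∣<∣p∣ x∈p)

0<∣p∣⇒nonempty : ∀ (p : Subset n) → 0 < ∣ p ∣ → Nonempty p
0<∣p∣⇒nonempty {n} p 0<∣p∣ with nonempty? p
... | yes ne = ne
... | no empty = ⊥-elim (n≮0 (subst (0 <_) (trans (cong ∣_∣ (Empty-unique empty)) (∣⊥∣≡0 n)) 0<∣p∣))

module _ {e : Subset n} (∣e∣≡3 : ∣ e ∣ ≡ 3) {a b : Fin n} (a∈e : a ∈ e) (b∈e : b ∈ e) (a≢b : a ≢ b) where
  open ≤-Reasoning

  third-∈ : ∃ λ c → c ∈ e × c ≢ a × c ≢ b
  third-∈ = third (0<∣p∣⇒nonempty (e - a - b) 0<∣e-a-b∣)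
    where
    0<∣e-a-b∣ : 0 < ∣ e - a - b ∣
    0<∣e-a-b∣ = ≤-pred (≤-pred (begin
      3                  ≡⟨ sym ∣e∣≡3 ⟩
      ∣ e ∣              ≤⟨ ∣p∣≤1+∣p-x∣ e a ⟩
      1 + ∣ e - a ∣      ≤⟨ s≤s (∣p∣≤1+∣p-x∣ (e - a) b) ⟩
      2 + ∣ e - a - b ∣  ∎))
    third : Nonempty (e - a - b) → ∃ λ c → c ∈ e × c ≢ a × c ≢ b
    third (c , c∈e-a-b) = c , x∈p-y⇒x∈p (x∈p-y⇒x∈p c∈e-a-b)
                            , x∈p-y⇒x≢y (x∈p-y⇒x∈p {p = e - a} c∈e-a-b)
                            , x∈p-y⇒x≢y {p = e - a} c∈e-a-b

  ∈-triple⁻ : ∀ {c v} → c ∈ e → a ≢ c → b ≢ c → v ∈ e → v ≡ a ⊎ v ≡ b ⊎ v ≡ c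
  ∈-triple⁻ {c} {v} c∈e a≢c b≢c v∈e with v ≟ᶠ a | v ≟ᶠ b | v ≟ᶠ c
  ... | yes v≡a | _       | _       = inj₁ v≡a
  ... | no _    | yes v≡b | _       = inj₂ (inj₁ v≡b)
  ... | no _    | no _    | yes v≡c = inj₂ (inj₂ v≡c)
  ... | no v≢a  | no v≢b  | no v≢c  = ⊥-elim (<-irrefl refl 3<3)
    where
    b∈e-a : b ∈ e - a
    b∈e-a = x∈p∧x≢y⇒x∈p-y b∈e (≢-sym a≢b)
    c∈e-a-b : c ∈ e - a - b
    c∈e-a-b = x∈p∧x≢y⇒x∈p-y (x∈p∧x≢y⇒x∈p-y c∈e (≢-sym a≢c)) (≢-sym b≢c)
    v∈e-a-b-c : v ∈ e - a - b - c
    v∈e-a-b-c = x∈p∧x≢y⇒x∈p-y (x∈p∧x≢y⇒x∈p-y (x∈p∧x≢y⇒x∈p-y v∈e v≢a) v≢b) v≢c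
    3<3 : 3 < 3
    3<3 = begin
      4                      ≤⟨ s≤s (s≤s (s≤s (x∈p⇒0<∣p∣ v∈e-a-b-c))) ⟩
      3 + ∣ e - a - b - c ∣  ≤⟨ s≤s (s≤s (x∈p⇒∣p-x∣<∣p∣ c∈e-a-b)) ⟩
      2 + ∣ e - a - b ∣      ≤⟨ s≤s (x∈p⇒∣p-x∣<∣p∣ b∈e-a) ⟩
      1 + ∣ e - a ∣          ≤⟨ x∈p⇒∣p-x∣<∣p∣ a∈e ⟩
      ∣ e ∣                  ≡⟨ ∣e∣≡3 ⟩
      3                      ∎

triple-unique : ∀ {e f : Subset n} → ∣ e ∣ ≡ 3 → ∣ f ∣ ≡ 3 → ∀ {a b c} →
  a ∈ e → b ∈ e → c ∈ e → a ∈ f → b ∈ f → c ∈ f → a ≢ b → a ≢ c → b ≢ c → e ≡ f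
triple-unique ∣e∣≡3 ∣f∣≡3 a∈e b∈e c∈e a∈f b∈f c∈f a≢b a≢c b≢c =
  ⊆-antisym (within ∣e∣≡3 a∈e b∈e c∈e a∈f b∈f c∈f) (within ∣f∣≡3 a∈f b∈f c∈f a∈e b∈e c∈e)
  where
  within : ∀ {e f} → ∣ e ∣ ≡ 3 → _ ∈ e → _ ∈ e → _ ∈ e → _ ∈ f → _ ∈ f → _ ∈ f → e ⊆ f
  within ∣e∣≡3 a∈e b∈e c∈e a∈f b∈f c∈f v∈e with ∈-triple⁻ ∣e∣≡3 a∈e b∈e a≢b c∈e a≢c b≢c v∈e
  ... | inj₁ refl        = a∈f
  ... | inj₂ (inj₁ refl) = b∈f
  ... | inj₂ (inj₂ refl) = c∈f

module _ {A : Set} (_≟_ : DecidableEquality A) where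

  remove : A → List A → List A
  remove a = filter (λ v → ¬? (v ≟ a))

  ∈-remove⁻ : ∀ {a v L} → v ∈ₗ remove a L → v ∈ₗ L × v ≢ a
  ∈-remove⁻ {a} = ∈-filter⁻ (λ v → ¬? (v ≟ a))

  ∈-remove⁺ : ∀ {a v L} → v ∈ₗ L → v ≢ a → v ∈ₗ remove a L
  ∈-remove⁺ {a} = ∈-filter⁺ (λ v → ¬? (v ≟ a))

  remove-unique : ∀ {a L} → Unique L → Unique (remove a L)
  remove-unique {a} = Unique.filter⁺ (λ v → ¬? (v ≟ a))

  length-remove-∈ : ∀ {a L} → a ∈ₗ L → suc (length (remove a L)) ≤ length L
  length-remove-∈ {a} {L} a∈L = filter-notAll (λ v → ¬? (v ≟ a)) L (Any.map (λ { refl ¬v≢a → ¬v≢a refl }) a∈L)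

  length≤1+length-remove : ∀ {a} L → Unique L → length L ≤ suc (length (remove a L))
  length≤1+length-remove []      _         = z≤n
  length≤1+length-remove {a} (v ∷ L) (v∉L ∷ L!) with v ≟ a
  ... | yes refl = s≤s (≤-reflexive (cong length (sym (filter-all (λ v → ¬? (v ≟ a)) (All.map ≢-sym v∉L)))))
  ... | no _     = s≤s (length≤1+length-remove L L!)

  Unique-⊆⇒length≤ : ∀ {M L} → Unique M → (∀ {v} → v ∈ₗ M → v ∈ₗ L) → length M ≤ length L
  Unique-⊆⇒length≤ {[]}    _          _   = z≤n
  Unique-⊆⇒length≤ {a ∷ M} {L} (a∉M ∷ M!) M⊆L =
    ≤-trans (s≤s (Unique-⊆⇒length≤ M! M⊆L-a)) (length-remove-∈ (M⊆L (here refl)))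
    where
    M⊆L-a : ∀ {v} → v ∈ₗ M → v ∈ₗ remove a L
    M⊆L-a v∈M = ∈-remove⁺ (M⊆L (there v∈M)) (λ { refl → All.lookup a∉M v∈M refl })

  doubled : (A → Bool → A) → List A → List A
  doubled f []      = []
  doubled f (w ∷ L) = f w true ∷ f w false ∷ doubled f L

  ∈-doubled⁻ : ∀ f L {v} → v ∈ₗ doubled f L → ∃ λ w → w ∈ₗ L × ∃ λ b → v ≡ f w b
  ∈-doubled⁻ f (w ∷ L) (here v≡)         = w , here refl , true , v≡
  ∈-doubled⁻ f (w ∷ L) (there (here v≡)) = w , here refl , false , v≡
  ∈-doubled⁻ f (w ∷ L) (there (there v∈)) with ∈-doubled⁻ f L v∈
  ... | w′ , w′∈L , b , v≡ = w′ , there w′∈L , b , v≡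

  length-doubled : ∀ f L → length (doubled f L) ≡ length L + length L
  length-doubled f []      = refl
  length-doubled f (w ∷ L) = cong suc (trans (cong suc (length-doubled f L)) (sym (+-suc (length L) (length L))))

  doubled-unique : ∀ f {L} → Unique L →
    (∀ {w w′ b b′} → w ∈ₗ L → w′ ∈ₗ L → f w b ≡ f w′ b′ → w ≡ w′ × b ≡ b′) → Unique (doubled f L)
  doubled-unique f {[]}    _          _   = []
  doubled-unique f {w ∷ L} (w∉L ∷ L!) inj =
    (f-true≢f-false ∷ All.tabulate (fresh true)) ∷ All.tabulate (fresh false)
    ∷ doubled-unique f L! (λ w∈ w′∈ → inj (there w∈) (there w′∈))
    where
    f-true≢f-false : f w true ≢ f w false
    f-true≢f-false eq with proj₂ (inj (here refl) (here refl) eq)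
    ... | ()
    fresh : ∀ b {v} → v ∈ₗ doubled f L → f w b ≢ v
    fresh b v∈ eq with ∈-doubled⁻ f L v∈
    ... | w′ , w′∈L , b′ , refl = All.lookup w∉L w′∈L (proj₁ (inj (here refl) (there w′∈L) eq))

  doubling-impossible : ∀ {L} → Unique L → (f : A → Bool → A) → (∀ {w} → w ∈ₗ L → ∀ b → f w b ∈ₗ L) →
    (∀ {w w′ b b′} → w ∈ₗ L → w′ ∈ₗ L → f w b ≡ f w′ b′ → w ≡ w′ × b ≡ b′) → L ≡ []
  doubling-impossible {[]}    _  _ _   _   = refl
  doubling-impossible {w ∷ L} L! f f∈L inj = ⊥-elim (m+1+n≰m (length (w ∷ L))
    (subst (_≤ length (w ∷ L)) (length-doubled f (w ∷ L)) (Unique-⊆⇒length≤ (doubled-unique f L! inj) images∈L)))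
    where
    images∈L : ∀ {v} → v ∈ₗ doubled f (w ∷ L) → v ∈ₗ w ∷ L
    images∈L v∈ with ∈-doubled⁻ f (w ∷ L) v∈
    ... | w′ , w′∈ , b , refl = f∈L w′∈ b

Unique-map⁺ : ∀ {A B : Set} (f : A → B) {L : List A} →
  (∀ {a b} → a ∈ₗ L → b ∈ₗ L → f a ≡ f b → a ≡ b) → Unique L → Unique (map f L)
Unique-map⁺ f {[]}    _   _          = []
Unique-map⁺ f {a ∷ L} inj (a∉L ∷ L!) = All.tabulate fresh ∷ Unique-map⁺ f (λ a∈ b∈ → inj (there a∈) (there b∈)) L!
  where
  fresh : ∀ {v} → v ∈ₗ map f L → f a ≢ v
  fresh v∈ eq with ∈-map⁻ f v∈
  ... | b , b∈L , refl = All.lookup a∉L b∈L (inj (here refl) (there b∈L) eq)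

three-distinct : ∀ {A : Set} {L : List A} → Unique L → 3 ≤ length L →
  ∃ λ a → ∃ λ b → ∃ λ c → a ∈ₗ L × b ∈ₗ L × c ∈ₗ L × a ≢ b × a ≢ c × b ≢ c
three-distinct {L = a ∷ b ∷ c ∷ _} ((a≢b ∷ a≢c ∷ _) ∷ (b≢c ∷ _) ∷ _) _ =
  a , b , c , here refl , there (here refl) , there (there (here refl)) , a≢b , a≢c , b≢c
three-distinct {L = []}        _ ()
three-distinct {L = _ ∷ []}     _ (s≤s ())
three-distinct {L = _ ∷ _ ∷ []} _ (s≤s (s≤s ()))

module _ {A : Set} {P : A → Set} (P? : Decidable P) where

  length-filter≡1 : ∀ {L e} → Unique L → e ∈ₗ L → P e → (∀ {e′} → e′ ∈ₗ L → P e′ → e′ ≡ e) →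
    length (filter P? L) ≡ 1
  length-filter≡1 {a ∷ L} (a∉L ∷ _) (here refl) Pa only rewrite filter-accept P? {xs = L} Pa
    | filter-none P? (All.tabulate {xs = L} (λ e′∈L Pe′ → All.lookup a∉L e′∈L (sym (only (there e′∈L) Pe′)))) = refl
  length-filter≡1 {a ∷ L} (a∉L ∷ L!) (there e∈L) Pe only
    rewrite filter-reject P? {xs = L} (λ Pa → All.lookup a∉L e∈L (only (here refl) Pa))
    = length-filter≡1 L! e∈L Pe (λ e′∈L → only (there e′∈L))

  another-∈ : DecidableEquality A → ∀ {L e} → Unique L → e ∈ₗ L → P e → length (filter P? L) ≢ 1 →
    ∃ λ e′ → e′ ∈ₗ L × P e′ × e′ ≢ e
  another-∈ _≟_ {L} {e} L! e∈L Pe ≢1 with any? (λ e′ → P? e′ ×-dec ¬? (e′ ≟ e)) L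
  ... | yes found = find found
  ... | no none   = ⊥-elim (≢1 (length-filter≡1 L! e∈L Pe only))
    where
    only : ∀ {e′} → e′ ∈ₗ L → P e′ → e′ ≡ e
    only e′∈L Pe′ = decidable-stable (_ ≟ e) λ e′≢e → none (Any.map (λ { refl → Pe′ , e′≢e }) e′∈L)

_∈ᵥ_ : ∀ {A : Set} {k} → A → Vector A k → Set
a ∈ᵥ U = AnyV (_≡ a) U

_∈ᵥ?_ : ∀ {k} (a : Fin n) (U : Vector (Fin n) k) → Dec (a ∈ᵥ U)
a ∈ᵥ? U = anyV? (_≟ᶠ a) U

∈ᵥ-∷⁻ : ∀ {A : Set} {k} {a w : A} {U : Vector A k} → a ∈ᵥ (w ∷ᵥ U) → a ≡ w ⊎ a ∈ᵥ U
∈ᵥ-∷⁻ (zero , w≡a)  = inj₁ (sym w≡a)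
∈ᵥ-∷⁻ (suc i , Ui≡a) = inj₂ (i , Ui≡a)

∉ᵥ-∷ : ∀ {A : Set} {k} {a w : A} {U : Vector A k} → a ≢ w → ¬ a ∈ᵥ U → ¬ a ∈ᵥ (w ∷ᵥ U)
∉ᵥ-∷ a≢w a∉U a∈ with ∈ᵥ-∷⁻ a∈
... | inj₁ a≡w = a≢w a≡w
... | inj₂ a∈U = a∉U a∈U

∷ᵥ-injective : ∀ {A : Set} {k} {w : A} {U : Vector A k} →
  ¬ w ∈ᵥ U → Injective _≡_ _≡_ U → Injective _≡_ _≡_ (w ∷ᵥ U)
∷ᵥ-injective w∉U U-inj {zero}  {zero}  _  = refl
∷ᵥ-injective w∉U U-inj {zero}  {suc j} eq = ⊥-elim (w∉U (j , sym eq))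
∷ᵥ-injective w∉U U-inj {suc i} {zero}  eq = ⊥-elim (w∉U (i , eq))
∷ᵥ-injective w∉U U-inj {suc i} {suc j} eq = cong suc (U-inj eq)

pair : ∀ {A : Set} → A → A → Vector A 2
pair a b = a ∷ᵥ b ∷ᵥ []ᵥ

pair-elim : ∀ {ℓ} {P : Fin 2 → Set ℓ} → P zero → P (suc zero) → ∀ i → P i
pair-elim P0 P1 = ∀-cons P0 (∀-cons P1 λ ())

pair-injective : ∀ {A : Set} {a b : A} → a ≢ b → Injective _≡_ _≡_ (pair a b)
pair-injective a≢b {zero}     {zero}     _  = refl
pair-injective a≢b {zero}     {suc zero} eq = ⊥-elim (a≢b eq)
pair-injective a≢b {suc zero} {zero}     eq = ⊥-elim (a≢b (sym eq))
pair-injective a≢b {suc zero} {suc zero} _  = refl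

Spans : Fin n → Fin n → Fin n → Subset n → Set
Spans a b c e = a ∈ e × b ∈ e × c ∈ e

EdgeThrough : Hypergraph3 n → Fin n → Fin n → Fin n → Set
EdgeThrough H a b c = Any (Spans a b c) (edges H)

edgeThrough? : ∀ (H : Hypergraph3 n) a b c → Dec (EdgeThrough H a b c)
edgeThrough? H a b c = any? (λ e → (a ∈? e) ×-dec ((b ∈? e) ×-dec (c ∈? e))) (edges H)

module _ (H : Hypergraph3 n) {a b c : Fin n} where

  edgeThrough-swap : EdgeThrough H a b c → EdgeThrough H a c b
  edgeThrough-swap = Any.map λ { (a∈ , b∈ , c∈) → a∈ , c∈ , b∈ }

  edgeThrough-rotate : EdgeThrough H a b c → EdgeThrough H b c a
  edgeThrough-rotate = Any.map λ { (a∈ , b∈ , c∈) → b∈ , c∈ , a∈ }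

∣edge∣≡3 : ∀ (H : Hypergraph3 n) {e} → e ∈ₗ edges H → ∣ e ∣ ≡ 3
∣edge∣≡3 H = All.lookup (uniform H)

record Star {n t} (H : Hypergraph3 n) (c o : Fin n) (u : Vector (Fin n) t) : Set where
  field
    third          : Vector (Fin n) t
    spans          : ∀ i → EdgeThrough H c (u i) (third i)
    third≢centre   : ∀ i → third i ≢ c
    third≢opposite : ∀ i → third i ≢ o
    third≢leaf     : ∀ i j → third i ≢ u j

module _ {t} {H : Hypergraph3 n} {c o : Fin n} {u : Vector (Fin n) t} (u≢c : ∀ i → u i ≢ c) (star : Star H c o u) where
  open Star star

  starEdge : Fin t → Subset n
  starEdge i = proj₁ (find (spans i))

  starEdge∈H : ∀ i → starEdge i ∈ₗ edges H
  starEdge∈H i = proj₁ (proj₂ (find (spans i)))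

  starEdge-spans : ∀ i → Spans c (u i) (third i) (starEdge i)
  starEdge-spans i = proj₂ (proj₂ (find (spans i)))

  ∈starEdge⁻ : ∀ {i v} → v ∈ starEdge i → v ≡ c ⊎ v ≡ u i ⊎ v ≡ third i
  ∈starEdge⁻ {i} = let (c∈ , u∈ , third∈) = starEdge-spans i in
    ∈-triple⁻ (∣edge∣≡3 H (starEdge∈H i)) c∈ u∈ (≢-sym (u≢c i))
              third∈ (≢-sym (third≢centre i)) (≢-sym (third≢leaf i i))

  starEdge-injective : Injective _≡_ _≡_ u → Injective _≡_ _≡_ starEdge
  starEdge-injective u-inj {i} {j} eq with ∈starEdge⁻ (subst (u i ∈_) eq (proj₁ (proj₂ (starEdge-spans i))))
  ... | inj₁ ui≡c         = ⊥-elim (u≢c i ui≡c)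
  ... | inj₂ (inj₁ ui≡uj) = u-inj ui≡uj
  ... | inj₂ (inj₂ ui≡tj) = ⊥-elim (third≢leaf j i (sym ui≡tj))

  opposite∉starEdge : c ≢ o → (∀ i → u i ≢ o) → ∀ i → o ∉ starEdge i
  opposite∉starEdge c≢o u≢o i o∈ with ∈starEdge⁻ o∈
  ... | inj₁ o≡c         = c≢o (sym o≡c)
  ... | inj₂ (inj₁ o≡ui) = u≢o i (sym o≡ui)
  ... | inj₂ (inj₂ o≡ti) = third≢opposite i (sym o≡ti)

  starEdge-trace : ∀ {i v} → v ∈ starEdge i → v ≢ third i → v ≡ c ⊎ v ≡ u i
  starEdge-trace v∈ v≢ti with ∈starEdge⁻ v∈
  ... | inj₁ v≡c         = inj₁ v≡c
  ... | inj₂ (inj₁ v≡ui) = inj₂ v≡ui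
  ... | inj₂ (inj₂ v≡ti) = ⊥-elim (v≢ti v≡ti)

trace-of-stars : ∀ {t} {H : Hypergraph3 n} {x y : Fin n} {u : Vector (Fin n) t} →
  x ≢ y → Injective _≡_ _≡_ u → (∀ i → u i ≢ x) → (∀ i → u i ≢ y) →
  Star H x y u → Star H y x u → K2tTrace t H
trace-of-stars {n} {t} {H} {x} {y} {u} x≢y u-inj u≢x u≢y starₓ starᵧ = record
  { x = x ; y = y ; u = u ; x≢y = x≢y ; u-inj = u-inj ; x∉u = u≢x ; y∉u = u≢y
  ; e = edge ; e-inj = edge-injective ; e∈H = edge∈H
  ; trace-x = λ i v → mk⇔ (λ (v∈ , v∈S) → starEdge-trace u≢x starₓ v∈ (third∉Sₓ v∈S))
                          λ { (inj₁ refl) → x∈ₓ i , inj₁ refl ; (inj₂ refl) → u∈ₓ i , inj₂ (inj₂ (i , refl)) }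
  ; trace-y = λ i v → mk⇔ (λ (v∈ , v∈S) → starEdge-trace u≢y starᵧ v∈ (third∉Sᵧ v∈S))
                          λ { (inj₁ refl) → y∈ᵧ i , inj₂ (inj₁ refl) ; (inj₂ refl) → u∈ᵧ i , inj₂ (inj₂ (i , refl)) }
  }
  where
  S : Fin n → Set
  S v = v ≡ x ⊎ v ≡ y ⊎ ∃ λ j → v ≡ u j
  edge : Fin t ⊎ Fin t → Subset n
  edge (inj₁ i) = starEdge u≢x starₓ i
  edge (inj₂ i) = starEdge u≢y starᵧ i
  edge∈H : ∀ k → edge k ∈ₗ edges H
  edge∈H (inj₁ i) = starEdge∈H u≢x starₓ i
  edge∈H (inj₂ i) = starEdge∈H u≢y starᵧ i
  x∈ₓ : ∀ i → x ∈ edge (inj₁ i)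
  x∈ₓ i = proj₁ (starEdge-spans u≢x starₓ i)
  u∈ₓ : ∀ i → u i ∈ edge (inj₁ i)
  u∈ₓ i = proj₁ (proj₂ (starEdge-spans u≢x starₓ i))
  y∈ᵧ : ∀ i → y ∈ edge (inj₂ i)
  y∈ᵧ i = proj₁ (starEdge-spans u≢y starᵧ i)
  u∈ᵧ : ∀ i → u i ∈ edge (inj₂ i)
  u∈ᵧ i = proj₁ (proj₂ (starEdge-spans u≢y starᵧ i))
  x∉edgeᵧ : ∀ j → x ∉ edge (inj₂ j)
  x∉edgeᵧ = opposite∉starEdge u≢y starᵧ (≢-sym x≢y) u≢x
  edge-injective : Injective _≡_ _≡_ edge
  edge-injective {inj₁ i} {inj₁ j} eq = cong inj₁ (starEdge-injective u≢x starₓ u-inj eq)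
  edge-injective {inj₂ i} {inj₂ j} eq = cong inj₂ (starEdge-injective u≢y starᵧ u-inj eq)
  edge-injective {inj₁ i} {inj₂ j} eq = ⊥-elim (x∉edgeᵧ j (subst (x ∈_) eq (x∈ₓ i)))
  edge-injective {inj₂ i} {inj₁ j} eq = ⊥-elim (x∉edgeᵧ i (subst (x ∈_) (sym eq) (x∈ₓ j)))
  third∉Sₓ : ∀ {i v} → S v → v ≢ Star.third starₓ i
  third∉Sₓ {i} (inj₁ refl)              = ≢-sym (Star.third≢centre starₓ i)
  third∉Sₓ {i} (inj₂ (inj₁ refl))       = ≢-sym (Star.third≢opposite starₓ i)
  third∉Sₓ {i} (inj₂ (inj₂ (j , refl))) = ≢-sym (Star.third≢leaf starₓ i j)
  third∉Sᵧ : ∀ {i v} → S v → v ≢ Star.third starᵧ i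
  third∉Sᵧ {i} (inj₁ refl)              = ≢-sym (Star.third≢opposite starᵧ i)
  third∉Sᵧ {i} (inj₂ (inj₁ refl))       = ≢-sym (Star.third≢centre starᵧ i)
  third∉Sᵧ {i} (inj₂ (inj₂ (j , refl))) = ≢-sym (Star.third≢leaf starᵧ i j)

bool-pigeonhole : ∀ (a b c : Bool) → a ≡ b ⊎ a ≡ c ⊎ b ≡ c
bool-pigeonhole true  true  _     = inj₁ refl
bool-pigeonhole false false _     = inj₁ refl
bool-pigeonhole true  false true  = inj₂ (inj₁ refl)
bool-pigeonhole false true  false = inj₂ (inj₁ refl)
bool-pigeonhole true  false false = inj₂ (inj₂ refl)
bool-pigeonhole false true  true  = inj₂ (inj₂ refl)

module Codegree (H : Hypergraph3 n) {x y : Fin n} (x≢y : x ≢ y) where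

  centre : Bool → Fin n
  centre true  = x
  centre false = y

  centre-opposite : ∀ s → centre s ≢ centre (not s)
  centre-opposite true  = x≢y
  centre-opposite false = ≢-sym x≢y

  NotCentre : Fin n → Set
  NotCentre v = v ≢ x × v ≢ y

  ≢centre : ∀ {v} → NotCentre v → ∀ s → v ≢ centre s
  ≢centre (v≢x , _) true  = v≢x
  ≢centre (_ , v≢y) false = v≢y

  Partner : Bool → Fin n → Fin n → Set
  Partner s z p = NotCentre p × p ≢ z × EdgeThrough H (centre s) z p

  partner? : ∀ s z p → Dec (Partner s z p)
  partner? s z p = (¬? (p ≟ᶠ x) ×-dec ¬? (p ≟ᶠ y)) ×-dec (¬? (p ≟ᶠ z) ×-dec edgeThrough? H (centre s) z p)

  partner-sym : ∀ {s z p} → NotCentre z → Partner s z p → Partner s p z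
  partner-sym z∉ (_ , p≢z , through) = z∉ , ≢-sym p≢z , edgeThrough-swap H through

  record Invariant {k} (U : Vector (Fin n) k) (A : List (Fin n)) : Set where
    field
      leaves-injective : Injective _≡_ _≡_ U
      leaf-notCentre   : ∀ i → NotCentre (U i)
      leaf-partner     : ∀ s i → ∃ λ p → Partner s (U i) p × ¬ p ∈ᵥ U × p ∉ₗ A
      pool-unique      : Unique A
      pool-notCentre   : ∀ {z} → z ∈ₗ A → NotCentre z
      pool-fresh       : ∀ {z} → z ∈ₗ A → ¬ z ∈ᵥ U
      pool-partner     : ∀ s {z} → z ∈ₗ A → ∃ λ p → Partner s z p × ¬ p ∈ᵥ U

  invariant⇒trace : ∀ {k U A} → Invariant {k} U A → K2tTrace k H
  invariant⇒trace {U = U} I =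
    trace-of-stars {u = U} x≢y leaves-injective (λ i → proj₁ (leaf-notCentre i)) (λ i → proj₂ (leaf-notCentre i))
                   (star true) (star false)
    where
    open Invariant I
    star : ∀ s → Star H (centre s) (centre (not s)) U
    star s = record
      { third          = λ i → proj₁ (leaf-partner s i)
      ; spans          = λ i → let (_ , (_ , _ , through) , _) = leaf-partner s i in through
      ; third≢centre   = λ i → ≢centre (proj₁ (proj₁ (proj₂ (leaf-partner s i)))) s
      ; third≢opposite = λ i → ≢centre (proj₁ (proj₁ (proj₂ (leaf-partner s i)))) (not s)
      ; third≢leaf     = λ i j p≡Uj → proj₁ (proj₂ (proj₂ (leaf-partner s i))) (j , sym p≡Uj)
      }

  module Step {k} {U : Vector (Fin n) k} {A : List (Fin n)} (I : Invariant U A) where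
    open Invariant I

    ForcedTo : Bool → Fin n → Fin n → Set
    ForcedTo s z w = z ∈ₗ A × (∀ p → Partner s z p → ¬ p ∈ᵥ U → p ≡ w)

    forcedTo? : ∀ s z w → Dec (ForcedTo s z w)
    forcedTo? s z w = any? (z ≟ᶠ_) A ×-dec all?ᶠ (λ p → partner? s z p →-dec (¬? (p ∈ᵥ? U) →-dec (p ≟ᶠ w)))

    Overloaded : Bool → Fin n → Set
    Overloaded s w = ∃₂ λ z₁ z₂ → z₁ ≢ z₂ × ForcedTo s z₁ w × ForcedTo s z₂ w

    overloaded? : ∀ s w → Dec (Overloaded s w)
    overloaded? s w = anyᶠ? λ z₁ → anyᶠ? λ z₂ → ¬? (z₁ ≟ᶠ z₂) ×-dec (forcedTo? s z₁ w ×-dec forcedTo? s z₂ w)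

    forced-partner : ∀ {s z w} → ForcedTo s z w → Partner s z w
    forced-partner {s} {z} (z∈A , only) = let (p , partner , p∉U) = pool-partner s z∈A in
      subst (Partner s z) (only p partner p∉U) partner

    forced-unique : ∀ {s z w w′} → ForcedTo s z w → ForcedTo s z w′ → w ≡ w′
    forced-unique {s} (z∈A , only) (_ , only′) with pool-partner s z∈A
    ... | p , partner , p∉U = trans (sym (only p partner p∉U)) (only′ p partner p∉U)

    -- Every vertex forced to z is an available partner of z, hence equal to w.
    forced⇒¬overloaded : ∀ {s z w} → ForcedTo s z w → ¬ Overloaded s z
    forced⇒¬overloaded {s} {z} {w} (_ , only) (z₁ , z₂ , z₁≢z₂ , forced₁ , forced₂) =
      z₁≢z₂ (trans (≡w forced₁) (sym (≡w forced₂)))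
      where
      ≡w : ∀ {z′} → ForcedTo s z′ z → z′ ≡ w
      ≡w forced = only _ (partner-sym (pool-notCentre (proj₁ forced)) (forced-partner forced)) (pool-fresh (proj₁ forced))

    -- A candidate forced to w becomes w's reserved partner, so it leaves the pool together with w.
    reserve : ∀ {s w} → w ∈ₗ A → ¬ Overloaded s w →
      ∃ λ r → Partner s w r × ¬ r ∈ᵥ U × (∀ {z} → ForcedTo s z w → z ≡ r)
    reserve {s} {w} w∈A ¬overloaded with anyᶠ? (λ z → forcedTo? s z w)
    ... | yes (z , forced) =
      z , partner-sym (pool-notCentre (proj₁ forced)) (forced-partner forced) , pool-fresh (proj₁ forced) , ≡z
      where
      ≡z : ∀ {z′} → ForcedTo s z′ w → z′ ≡ z
      ≡z {z′} forced′ = decidable-stable (z′ ≟ᶠ z) λ z′≢z → ¬overloaded (z′ , z , z′≢z , forced′ , forced)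
    ... | no none with pool-partner s w∈A
    ...   | p , partner , p∉U = p , partner , p∉U , λ forced → ⊥-elim (none (_ , forced))

    overloaded-somewhere? : ∀ w → Dec (∃ λ s → Overloaded s w)
    overloaded-somewhere? w with overloaded? true w | overloaded? false w
    ... | yes o | _     = yes (true , o)
    ... | no _  | yes o = yes (false , o)
    ... | no ¬t | no ¬f = no λ { (true , o) → ¬t o ; (false , o) → ¬f o }

    Usable : Fin n → Set
    Usable w = ¬ ∃ λ s → Overloaded s w

    -- Two distinct vertices forced to w when w is not usable (junk w otherwise).
    forcedPair : Fin n → Bool → Fin n
    forcedPair w b with overloaded-somewhere? w
    ... | yes (_ , z₁ , z₂ , _) = if b then z₁ else z₂
    ... | no _                  = w

    module AllUnusable (unusable : ∀ {w} → w ∈ₗ A → ¬ Usable w) where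

      forcedPair-forced : ∀ {w} → w ∈ₗ A → ∀ b → ∃ λ s → ForcedTo s (forcedPair w b) w
      forcedPair-forced {w} w∈A b with overloaded-somewhere? w | b
      ... | yes (s , _ , _ , _ , forced₁ , _) | true  = s , forced₁
      ... | yes (s , _ , _ , _ , _ , forced₂) | false = s , forced₂
      ... | no usable                         | _     = ⊥-elim (unusable w∈A usable)

      forcedPair-distinct : ∀ {w} → w ∈ₗ A → forcedPair w true ≢ forcedPair w false
      forcedPair-distinct {w} w∈A with overloaded-somewhere? w
      ... | yes (_ , _ , _ , z₁≢z₂ , _) = z₁≢z₂
      ... | no usable                   = ⊥-elim (unusable w∈A usable)

      same-parent : ∀ {w w′ b b′} → w ∈ₗ A → forcedPair w b ≡ forcedPair w′ b′ → w ≡ w′ → w ≡ w′ × b ≡ b′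
      same-parent {b = true}  {true}  _   _  refl = refl , refl
      same-parent {b = false} {false} _   _  refl = refl , refl
      same-parent {b = true}  {false} w∈A eq refl = ⊥-elim (forcedPair-distinct w∈A eq)
      same-parent {b = false} {true}  w∈A eq refl = ⊥-elim (forcedPair-distinct w∈A (sym eq))

      -- A vertex forced on both sides would be usable.
      forced-one-side : ∀ {z w w′} → ForcedTo true z w → ¬ ForcedTo false z w′
      forced-one-side forcedₓ forcedᵧ = unusable (proj₁ forcedₓ) λ
        { (true , o) → forced⇒¬overloaded forcedₓ o ; (false , o) → forced⇒¬overloaded forcedᵧ o }

      forcedPair-injective : ∀ {w w′ b b′} → w ∈ₗ A → w′ ∈ₗ A →
        forcedPair w b ≡ forcedPair w′ b′ → w ≡ w′ × b ≡ b′
      forcedPair-injective {w} {w′} {b} {b′} w∈A w′∈A eq =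
        compare (forcedPair-forced w∈A b) (subst (λ z → ∃ λ s → ForcedTo s z w′) (sym eq) (forcedPair-forced w′∈A b′))
        where
        compare : (∃ λ s → ForcedTo s (forcedPair w b) w) → (∃ λ s → ForcedTo s (forcedPair w b) w′) → w ≡ w′ × b ≡ b′
        compare (true  , forced) (true  , forced′) = same-parent w∈A eq (forced-unique forced forced′)
        compare (false , forced) (false , forced′) = same-parent w∈A eq (forced-unique forced forced′)
        compare (true  , forced) (false , forced′) = ⊥-elim (forced-one-side forced forced′)
        compare (false , forced) (true  , forced′) = ⊥-elim (forced-one-side forced′ forced)

      pool-empty : A ≡ []
      pool-empty = doubling-impossible _≟ᶠ_ pool-unique forcedPair
        (λ w∈A b → proj₁ (proj₂ (forcedPair-forced w∈A b))) forcedPair-injective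

    usable-exists : 0 < length A → ∃ λ w → w ∈ₗ A × Usable w
    usable-exists 0<∣A∣ with any? (λ w → ¬? (overloaded-somewhere? w)) A
    ... | yes found = find found
    ... | no none   = ⊥-elim (n≮0 (subst (λ L → 0 < length L) (AllUnusable.pool-empty unusable) 0<∣A∣))
      where
      unusable : ∀ {w} → w ∈ₗ A → ¬ Usable w
      unusable w∈A usable = none (Any.map (λ { refl → usable }) w∈A)

    module Extend {w} (w∈A : w ∈ₗ A) (usable : Usable w) where

      reserved : ∀ s → ∃ λ r → Partner s w r × ¬ r ∈ᵥ U × (∀ {z} → ForcedTo s z w → z ≡ r)
      reserved s = reserve w∈A λ o → usable (s , o)

      r : Bool → Fin n
      r s = proj₁ (reserved s)

      U′ : Vector (Fin n) (suc k)
      U′ = w ∷ᵥ U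

      A′ : List (Fin n)
      A′ = remove _≟ᶠ_ (r false) (remove _≟ᶠ_ (r true) (remove _≟ᶠ_ w A))

      ∈A′⁻ : ∀ {z} → z ∈ₗ A′ → z ∈ₗ A × z ≢ w × ∀ s → z ≢ r s
      ∈A′⁻ z∈A′ with ∈-remove⁻ _≟ᶠ_ z∈A′
      ... | z∈ , z≢rᵧ with ∈-remove⁻ _≟ᶠ_ z∈
      ... | z∈′ , z≢rₓ with ∈-remove⁻ _≟ᶠ_ z∈′
      ... | z∈A , z≢w = z∈A , z≢w , λ { true → z≢rₓ ; false → z≢rᵧ }

      length-A′ : length A ≤ 3 + length A′
      length-A′ = ≤-trans (length≤1+length-remove _≟ᶠ_ A pool-unique)
        (s≤s (≤-trans (length≤1+length-remove _≟ᶠ_ _ (remove-unique _≟ᶠ_ pool-unique))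
        (s≤s (length≤1+length-remove _≟ᶠ_ _ (remove-unique _≟ᶠ_ (remove-unique _≟ᶠ_ pool-unique))))))

      leaf-partner′ : ∀ s i → ∃ λ p → Partner s (U′ i) p × ¬ p ∈ᵥ U′ × p ∉ₗ A′
      leaf-partner′ s zero = let (_ , partner , r∉U , _) = reserved s in
        r s , partner , ∉ᵥ-∷ (proj₁ (proj₂ partner)) r∉U , λ r∈A′ → proj₂ (proj₂ (∈A′⁻ r∈A′)) s refl
      leaf-partner′ s (suc i) with leaf-partner s i
      ... | p , partner , p∉U , p∉A =
        p , partner , ∉ᵥ-∷ (λ { refl → p∉A w∈A }) p∉U , λ p∈A′ → p∉A (proj₁ (∈A′⁻ p∈A′))

      -- If z had no partner outside U′, it would be forced to w, and then z would be r s.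
      pool-partner′ : ∀ s {z} → z ∈ₗ A′ → ∃ λ p → Partner s z p × ¬ p ∈ᵥ U′
      pool-partner′ s {z} z∈A′ with anyᶠ? (λ p → partner? s z p ×-dec ¬? (p ∈ᵥ? U′))
      ... | yes found = found
      ... | no none   = ⊥-elim (proj₂ (proj₂ (∈A′⁻ z∈A′)) s z≡r)
        where
        forced : ∀ p → Partner s z p → ¬ p ∈ᵥ U → p ≡ w
        forced p partner p∉U = decidable-stable (p ≟ᶠ w) λ p≢w → none (p , partner , ∉ᵥ-∷ p≢w p∉U)
        z≡r : z ≡ r s
        z≡r = proj₂ (proj₂ (proj₂ (reserved s))) (proj₁ (∈A′⁻ z∈A′) , forced)

      invariant′ : Invariant U′ A′
      invariant′ = record
        { leaves-injective = ∷ᵥ-injective (pool-fresh w∈A) leaves-injective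
        ; leaf-notCentre   = ∀-cons (pool-notCentre w∈A) leaf-notCentre
        ; leaf-partner     = leaf-partner′
        ; pool-unique      = remove-unique _≟ᶠ_ (remove-unique _≟ᶠ_ (remove-unique _≟ᶠ_ pool-unique))
        ; pool-notCentre   = λ z∈A′ → pool-notCentre (proj₁ (∈A′⁻ z∈A′))
        ; pool-fresh       = λ z∈A′ → ∉ᵥ-∷ (proj₁ (proj₂ (∈A′⁻ z∈A′))) (pool-fresh (proj₁ (∈A′⁻ z∈A′)))
        ; pool-partner     = pool-partner′
        }

  grow : ∀ t {k} {U : Vector (Fin n) k} {A} → Invariant U A → t * 3 ∸ 2 ≤ length A → K2tTrace (t + k) H
  grow zero    I _ = invariant⇒trace I
  grow (suc t) {k} I large with Step.usable-exists I (≤-trans (s≤s z≤n) large)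
  ... | w , w∈A , usable = subst (λ m → K2tTrace m H) (+-suc t k)
                             (grow t invariant′ (m≤n+o⇒m∸n≤o (t * 3) 2 (≤-pred (≤-trans large length-A′))))
    where open Step.Extend I w∈A usable

  spineEdges : List (Subset n)
  spineEdges = filter (λ e → (x ∈? e) ×-dec (y ∈? e)) (edgesMinusA H)

  -- The vertex of e other than x and y (junk x if there is none).
  apex : Subset n → Fin n
  apex e with anyᶠ? (λ z → (z ∈? e) ×-dec (¬? (z ≟ᶠ x) ×-dec ¬? (z ≟ᶠ y)))
  ... | yes (z , _) = z
  ... | no _        = x

  apex-spec : ∀ {e} → ∣ e ∣ ≡ 3 → x ∈ e → y ∈ e → apex e ∈ e × NotCentre (apex e)
  apex-spec {e} ∣e∣≡3 x∈e y∈e with anyᶠ? (λ z → (z ∈? e) ×-dec (¬? (z ≟ᶠ x) ×-dec ¬? (z ≟ᶠ y)))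
  ... | yes (_ , spec) = spec
  ... | no none        = ⊥-elim (none (third-∈ ∣e∣≡3 x∈e y∈e x≢y))

  pool₀ : List (Fin n)
  pool₀ = map apex spineEdges

  length-pool₀ : length pool₀ ≡ dMinusA H x y
  length-pool₀ = length-map apex spineEdges

  record Spine (z : Fin n) : Set where
    field
      edge      : Subset n
      edge∈H    : edge ∈ₗ edges H
      edge∉A    : ¬ InA H edge
      spans     : Spans x y z edge
      notCentre : NotCentre z

  ∈spineEdges⁻ : ∀ {e} → e ∈ₗ spineEdges → e ∈ₗ edges H × ¬ InA H e × x ∈ e × y ∈ e
  ∈spineEdges⁻ e∈ with ∈-filter⁻ (λ e → (x ∈? e) ×-dec (y ∈? e)) {xs = edgesMinusA H} e∈
  ... | e∈H∖A , x∈e , y∈e with ∈-filter⁻ (λ e → ¬? (inA? H e)) {xs = edges H} e∈H∖A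
  ... | e∈H , e∉A = e∈H , e∉A , x∈e , y∈e

  ∈pool₀⁻ : ∀ {z} → z ∈ₗ pool₀ → Spine z
  ∈pool₀⁻ z∈ with ∈-map⁻ apex z∈
  ... | e , e∈ , refl with ∈spineEdges⁻ e∈
  ... | e∈H , e∉A , x∈e , y∈e with apex-spec (∣edge∣≡3 H e∈H) x∈e y∈e
  ... | apex∈e , notCentre = record { edge = e ; edge∈H = e∈H ; edge∉A = e∉A ; spans = x∈e , y∈e , apex∈e ; notCentre = notCentre }

  pool₀-unique : Unique pool₀
  pool₀-unique = Unique-map⁺ apex apex-injective (Unique.filter⁺ _ (Unique.filter⁺ _ (unique H)))
    where
    apex-injective : ∀ {e f} → e ∈ₗ spineEdges → f ∈ₗ spineEdges → apex e ≡ apex f → e ≡ f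
    apex-injective e∈ f∈ eq with ∈spineEdges⁻ e∈ | ∈spineEdges⁻ f∈
    ... | e∈H , _ , x∈e , y∈e | f∈H , _ , x∈f , y∈f
      with apex-spec (∣edge∣≡3 H e∈H) x∈e y∈e | apex-spec (∣edge∣≡3 H f∈H) x∈f y∈f
    ... | apex∈e , (apex≢x , apex≢y) | apex∈f , _ =
      triple-unique (∣edge∣≡3 H e∈H) (∣edge∣≡3 H f∈H) x∈e y∈e apex∈e x∈f y∈f (subst (_∈ _) (sym eq) apex∈f)
                    x≢y (≢-sym apex≢x) (≢-sym apex≢y)

  centre-∈ : ∀ s {e} → x ∈ e → y ∈ e → centre s ∈ e
  centre-∈ true  x∈e _   = x∈e
  centre-∈ false _   y∈e = y∈e

  centres-∈ : ∀ s {e} → centre s ∈ e → centre (not s) ∈ e → x ∈ e × y ∈ e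
  centres-∈ true  c∈e o∈e = c∈e , o∈e
  centres-∈ false c∈e o∈e = o∈e , c∈e

  ≢centres⇒notCentre : ∀ s {v} → v ≢ centre s → v ≢ centre (not s) → NotCentre v
  ≢centres⇒notCentre true  v≢c v≢o = v≢c , v≢o
  ≢centres⇒notCentre false v≢c v≢o = v≢o , v≢c

  -- The spine edge xyz is not in A, so d(c, z) ≠ 1 and a second edge through c and z supplies the partner.
  spine-partner : ∀ s {z} → Spine z → ∃ λ p → Partner s z p
  spine-partner s {z} spine =
    partner (another-∈ (λ e → (centre s ∈? e) ×-dec (z ∈? e)) (≡-dec _≟ᵇ_) (unique H) edge∈H (c∈edge , z∈edge) d≢1)
    where
    open Spine spine
    x∈edge : x ∈ edge
    x∈edge = proj₁ spans
    y∈edge : y ∈ edge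
    y∈edge = proj₁ (proj₂ spans)
    z∈edge : z ∈ edge
    z∈edge = proj₂ (proj₂ spans)
    c∈edge : centre s ∈ edge
    c∈edge = centre-∈ s x∈edge y∈edge
    c≢z : centre s ≢ z
    c≢z = ≢-sym (≢centre notCentre s)
    d≢1 : d H (centre s) z ≢ 1
    d≢1 d≡1 = edge∉A (centre s , z , c≢z , c∈edge , z∈edge , d≡1)
    partner : (∃ λ f → f ∈ₗ edges H × (centre s ∈ f × z ∈ f) × f ≢ edge) → ∃ λ p → Partner s z p
    partner (f , f∈H , (c∈f , z∈f) , f≢edge) with third-∈ (∣edge∣≡3 H f∈H) c∈f z∈f c≢z
    ... | p , p∈f , p≢c , p≢z = p , (≢centres⇒notCentre s p≢c p≢o , p≢z , Any.map (λ { refl → c∈f , z∈f , p∈f }) f∈H)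
      where
      p≢o : p ≢ centre (not s)
      p≢o p≡o with centres-∈ s c∈f (subst (_∈ f) p≡o p∈f)
      ... | x∈f , y∈f = f≢edge (triple-unique (∣edge∣≡3 H f∈H) (∣edge∣≡3 H edge∈H) x∈f y∈f z∈f x∈edge y∈edge z∈edge
                                              x≢y (≢-sym (proj₁ notCentre)) (≢-sym (proj₂ notCentre)))

  spine-through : ∀ {z} → Spine z → ∀ s → EdgeThrough H (centre (not s)) z (centre s)
  spine-through spine s = Any.map (λ { refl → through s spans }) edge∈H
    where
    open Spine spine
    through : ∀ s {e} → Spans x y _ e → Spans (centre (not s)) _ (centre s) e
    through true  (x∈ , y∈ , z∈) = y∈ , z∈ , x∈
    through false (x∈ , y∈ , z∈) = x∈ , z∈ , y∈

  invariant₀ : Invariant []ᵥ pool₀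
  invariant₀ = record
    { leaves-injective = λ { {()} }
    ; leaf-notCentre   = λ ()
    ; leaf-partner     = λ _ ()
    ; pool-unique      = pool₀-unique
    ; pool-notCentre   = λ z∈ → Spine.notCentre (∈pool₀⁻ z∈)
    ; pool-fresh       = λ _ ()
    ; pool-partner     = λ s z∈ → let (p , partner) = spine-partner s (∈pool₀⁻ z∈) in p , partner , λ ()
    }

  large-codegree⇒trace : ∀ t → t * 3 ∸ 2 ≤ dMinusA H x y → K2tTrace t H
  large-codegree⇒trace t large = subst (λ m → K2tTrace m H) (+-identityʳ t)
    (grow t invariant₀ (subst (t * 3 ∸ 2 ≤_) (sym length-pool₀) large))

  Avoids : Bool → Fin n → Fin n → Set
  Avoids s a b = ∃ λ p → Partner s a p × p ≢ b

  avoids-or-through : ∀ s {a} → Spine a → ∀ b → Avoids s a b ⊎ EdgeThrough H (centre s) a b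
  avoids-or-through s {a} spine b = decide (anyᶠ? λ p → partner? s a p ×-dec ¬? (p ≟ᶠ b))
    where
    decide : Dec (Avoids s a b) → Avoids s a b ⊎ EdgeThrough H (centre s) a b
    decide (yes avoids) = inj₁ avoids
    decide (no none)    = let (p , partner) = spine-partner s spine in
      inj₂ (subst (EdgeThrough H (centre s) a) (decidable-stable (p ≟ᶠ b) λ p≢b → none (p , partner , p≢b))
                  (proj₂ (proj₂ partner)))

  avoiding-star : ∀ s {a b} → Avoids s a b → Avoids s b a → Star H (centre s) (centre (not s)) (pair a b)
  avoiding-star s (p , (p∉ , p≢a , through-p) , p≢b) (q , (q∉ , q≢b , through-q) , q≢a) = record
    { third          = pair p q
    ; spans          = pair-elim through-p through-q
    ; third≢centre   = pair-elim (≢centre p∉ s) (≢centre q∉ s)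
    ; third≢opposite = pair-elim (≢centre p∉ (not s)) (≢centre q∉ (not s))
    ; third≢leaf     = pair-elim (pair-elim p≢a p≢b) (pair-elim q≢a q≢b)
    }

  avoid-each-other-or-through : ∀ s {a b} → Spine a → Spine b →
    (Avoids s a b × Avoids s b a) ⊎ EdgeThrough H (centre s) a b
  avoid-each-other-or-through s {a} {b} sa sb with avoids-or-through s sa b | avoids-or-through s sb a
  ... | inj₁ ab      | inj₁ ba      = inj₁ (ab , ba)
  ... | inj₂ through | _            = inj₂ through
  ... | inj₁ _       | inj₂ through = inj₂ (edgeThrough-swap H through)

  pair-trace-or-through : ∀ {a b} → Spine a → Spine b → a ≢ b → K2tTrace 2 H ⊎ ∃ λ s → EdgeThrough H (centre s) a b
  pair-trace-or-through sa sb a≢b with avoid-each-other-or-through true sa sb | avoid-each-other-or-through false sa sb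
  ... | inj₂ through       | _                  = inj₂ (true , through)
  ... | inj₁ _             | inj₂ through       = inj₂ (false , through)
  ... | inj₁ (abₓ , baₓ)   | inj₁ (abᵧ , baᵧ)   = inj₁ (trace-of-stars x≢y (pair-injective a≢b)
    (pair-elim (proj₁ (Spine.notCentre sa)) (proj₁ (Spine.notCentre sb)))
    (pair-elim (proj₂ (Spine.notCentre sa)) (proj₂ (Spine.notCentre sb)))
    (avoiding-star true abₓ baₓ) (avoiding-star false abᵧ baᵧ))

  -- With c = centre s and o the other centre: centres o and k, leaves i and j,
  -- edges o i c and o j c (spine edges) and k i c and k j c.
  fan-trace : ∀ s {k i j} → Spine k → Spine i → Spine j → k ≢ i → k ≢ j → i ≢ j →
    EdgeThrough H (centre s) k i → EdgeThrough H (centre s) k j → K2tTrace 2 H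
  fan-trace s sk si sj k≢i k≢j i≢j through-i through-j =
    trace-of-stars (≢-sym (≢centre (Spine.notCentre sk) (not s))) (pair-injective i≢j)
      (pair-elim (≢centre (Spine.notCentre si) (not s)) (≢centre (Spine.notCentre sj) (not s)))
      (pair-elim (≢-sym k≢i) (≢-sym k≢j)) spineStar fanStar
    where
    c≢k : centre s ≢ _
    c≢k = ≢-sym (≢centre (Spine.notCentre sk) s)
    c≢leaf : ∀ l → centre s ≢ pair _ _ l
    c≢leaf = pair-elim (≢-sym (≢centre (Spine.notCentre si) s)) (≢-sym (≢centre (Spine.notCentre sj) s))
    spineStar : Star H (centre (not s)) _ (pair _ _)
    spineStar = record
      { third          = λ _ → centre s
      ; spans          = pair-elim (spine-through si s) (spine-through sj s)
      ; third≢centre   = λ _ → centre-opposite s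
      ; third≢opposite = λ _ → c≢k
      ; third≢leaf     = λ _ → c≢leaf
      }
    fanStar : Star H _ (centre (not s)) (pair _ _)
    fanStar = record
      { third          = λ _ → centre s
      ; spans          = pair-elim (edgeThrough-rotate H through-i) (edgeThrough-rotate H through-j)
      ; third≢centre   = λ _ → c≢k
      ; third≢opposite = λ _ → centre-opposite s
      ; third≢leaf     = λ _ → c≢leaf
      }

  three-spines⇒trace : ∀ {a b c} → Spine a → Spine b → Spine c → a ≢ b → a ≢ c → b ≢ c → K2tTrace 2 H
  three-spines⇒trace sa sb sc a≢b a≢c b≢c
    with pair-trace-or-through sa sb a≢b | pair-trace-or-through sa sc a≢c | pair-trace-or-through sb sc b≢c
  ... | inj₁ τ | _      | _      = τ
  ... | inj₂ _ | inj₁ τ | _      = τ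
  ... | inj₂ _ | inj₂ _ | inj₁ τ = τ
  ... | inj₂ (s₁ , ab) | inj₂ (s₂ , ac) | inj₂ (s₃ , bc) with bool-pigeonhole s₁ s₂ s₃
  ...   | inj₁ refl        = fan-trace s₁ sa sb sc a≢b a≢c b≢c ab ac
  ...   | inj₂ (inj₁ refl) = fan-trace s₁ sb sa sc (≢-sym a≢b) b≢c a≢c (edgeThrough-swap H ab) bc
  ...   | inj₂ (inj₂ refl) = fan-trace s₂ sc sa sb (≢-sym a≢c) (≢-sym b≢c) a≢b (edgeThrough-swap H ac) (edgeThrough-swap H bc)

  three-codegree⇒K22 : 3 ≤ dMinusA H x y → K2tTrace 2 H
  three-codegree⇒K22 large with three-distinct pool₀-unique (subst (3 ≤_) (sym length-pool₀) large)
  ... | a , b , c , a∈ , b∈ , c∈ , a≢b , a≢c , b≢c =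
    three-spines⇒trace (∈pool₀⁻ a∈) (∈pool₀⁻ b∈) (∈pool₀⁻ c∈) a≢b a≢c b≢c

lemma3p1 : (t n : ℕ) → 2 ≤ t → (H : Hypergraph3 n) → ¬ ContainsK2tTrace t H →
    (x y : Fin n) → x ≢ y →
      (dMinusA H x y ≤ 3 * t ∸ 3) × (t ≡ 2 → dMinusA H x y ≤ 2)
lemma3p1 (suc t) n _ H no-trace x y x≢y = bound , bound-t≡2
  where
  open Codegree H x≢y
  bound : dMinusA H x y ≤ 3 * suc t ∸ 3
  bound = subst (λ m → dMinusA H x y ≤ m ∸ 3) (*-comm (suc t) 3)
    (decidable-stable (_ ≤? t * 3) λ small → no-trace (large-codegree⇒trace (suc t) (≰⇒> small)))
  bound-t≡2 : suc t ≡ 2 → dMinusA H x y ≤ 2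
  bound-t≡2 t≡2 = decidable-stable (_ ≤? 2) λ small →
    no-trace (subst (λ m → K2tTrace m H) (sym t≡2) (three-codegree⇒K22 (≰⇒> small)))
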